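{- Let $G$ be a connected graph. Then $G$ is a square if and only if $G\nabla K_1$ is a square.
   Context: The join $G\nabla H$ has vertex set $V(G)\sqcup V(H)$ and edge set $E(G)\cup E(H)\cup\{gh: g\in V(G),h\in V(H)\}$; thus $G\nabla K_1$ is $G$ with one new vertex adjacent to all vertices of $G$. All graphs are finite and simple. A partially labeled graph is a graph $K$ together with an injective map $\theta: L\to V(K)$, $L\subseteq\mathbb{N}$, whose image $\theta(L)$ is nonempty and a proper subset of $V(K)$; vertices in $\theta(L)$ are labeled. The square $KK$ is obtained from two disjoint copies of $K$ by identifying each labeled vertex $\theta(\ell)$ of the first copy with $\theta(\ell)$ of the second copy (keeping all edges, merging double edges). A graph is a square if it is isomorphic to $KK$ for some partially labeled graph $K$. -}

module Defs where

open import Data.Nat using (ℕ; suc)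
open import Data.Fin using (Fin; zero; suc)
open import Data.Bool using (Bool; true; false; _∧_)
open import Data.Sum using (_⊎_; inj₁; inj₂)
open import Data.Product using (Σ; ∃; _×_; _,_)
open import Relation.Binary.PropositionalEquality using (_≡_; refl)
open import Function.Bundles using (_⤖_; module Bijection)

record Graph : Set where
  field
    n      : ℕ
    adj    : Fin n → Fin n → Bool
    sym    : ∀ i j → adj i j ≡ adj j i
    irrefl : ∀ i → adj i i ≡ false
open Graph public

data Reach (G : Graph) : Fin (n G) → Fin (n G) → Set where
  here : ∀ {u} → Reach G u u
  step : ∀ {u w v} → adj G u w ≡ true → Reach G w v → Reach G u v

Connected : Graph → Set
Connected G = ∀ u v → Reach G u v

joinAdj : (G : Graph) → Fin (suc (n G)) → Fin (suc (n G)) → Bool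
joinAdj G zero    zero    = false
joinAdj G zero    (suc j) = true
joinAdj G (suc i) zero    = true
joinAdj G (suc i) (suc j) = adj G i j

joinSym : (G : Graph) → ∀ i j → joinAdj G i j ≡ joinAdj G j i
joinSym G zero    zero    = refl
joinSym G zero    (suc j) = refl
joinSym G (suc i) zero    = refl
joinSym G (suc i) (suc j) = sym G i j

joinIrrefl : (G : Graph) → ∀ i → joinAdj G i i ≡ false
joinIrrefl G zero    = refl
joinIrrefl G (suc i) = irrefl G i

_∇K₁ : Graph → Graph
G ∇K₁ = record { n = suc (n G) ; adj = joinAdj G
               ; sym = joinSym G ; irrefl = joinIrrefl G }

-- Partially labeled graph: a graph K together with the set of labeled
-- vertices S (the image θ(L) of the injective labeling; only the image
-- matters for the square), required nonempty and a proper subset of V(K).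
record PLGraph : Set where
  field
    K         : Graph
    labeled   : Fin (n K) → Bool
    nonempty  : ∃ λ v → labeled v ≡ true
    proper    : ∃ λ v → labeled v ≡ false
open PLGraph public

-- Vertex set of the square KK: the first copy of V(K), plus the
-- unlabeled vertices of the second copy (labeled vertices of the second
-- copy are identified with those of the first copy).
SqV : PLGraph → Set
SqV P = Fin (n (K P)) ⊎ Σ (Fin (n (K P))) (λ v → labeled P v ≡ false)

-- Adjacency in KK: edges of both copies, transported along the
-- identification (double edges merged).
sqAdj : (P : PLGraph) → SqV P → SqV P → Bool
sqAdj P (inj₁ a)       (inj₁ b)       = adj (K P) a b
sqAdj P (inj₂ (a , _)) (inj₂ (b , _)) = adj (K P) a b
sqAdj P (inj₁ a)       (inj₂ (b , _)) = labeled P a ∧ adj (K P) a b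
sqAdj P (inj₂ (a , _)) (inj₁ b)       = adj (K P) a b ∧ labeled P b

IsoToSquare : Graph → PLGraph → Set
IsoToSquare G P =
  Σ (Fin (n G) ⤖ SqV P) λ f →
    ∀ i j → adj G i j ≡ sqAdj P (Bijection.to f i) (Bijection.to f j)

IsSquare : Graph → Set
IsSquare G = ∃ λ (P : PLGraph) → IsoToSquare G P

{-# OPTIONS --safe #-}
module Submission where

open import Defs hiding (sym)
open import Function.Bundles using (_⇔_)

open import Data.Nat using (suc; pred)
open import Data.Fin using (Fin; zero; suc; punchIn; punchOut)
open import Data.Fin.Properties
  using (punchIn-injective; punchInᵢ≢i; punchIn-punchOut; 0≢1+n; suc-injective; any?)
  renaming (_≟_ to _≟ᶠ_)
open import Data.Bool using (Bool; true; false)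
open import Data.Bool.Properties using (∧-conicalˡ; ∧-conicalʳ) renaming (_≟_ to _≟ᵇ_)
open import Data.Sum using (_⊎_; inj₁; inj₂)
open import Data.Sum.Properties using (inj₁-injective; inj₂-injective)
open import Data.Product using (Σ; ∃; _×_; _,_; proj₁; proj₂)
open import Data.Empty using (⊥; ⊥-elim)
open import Function using (_∘_)
open import Function.Bundles using (_⤖_; module Bijection; mk⤖; mk⇔)
open import Function.Definitions using (Injective)
open import Function.Consequences.Propositional using (strictlySurjective⇒surjective)
open import Relation.Nullary using (¬_; yes; no)
open import Relation.Nullary.Decidable using (_×-dec_; ¬?; decidable-stable)
open import Relation.Binary.PropositionalEquality
  using (_≡_; _≢_; refl; sym; trans; cong; cong₂; module ≡-Reasoning)
open import Axiom.UniquenessOfIdentityProofs using (module Decidable⇒UIP)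

-- Forward: if G ≅ KK, label the apex of K ∇ K₁; then G ∇ K₁ ≅ (K ∇ K₁)(K ∇ K₁).
-- Backward: in a square KK only a labeled vertex of K can be adjacent to all
-- other vertices, so the apex of G ∇ K₁ is some labeled a. If a were the only
-- labeled vertex, deleting it would leave the two copies of K ∖ a with no edge
-- between them, contradicting the connectedness of G; hence K ∖ a, labeled by
-- the remaining labeled vertices, is a partially labeled graph, and G ≅ (K ∖ a)(K ∖ a).

Σ-≡-by-proj₁ : {V : Set} {ℓ : V → Bool} {c : Bool} {u v : V} {p : ℓ u ≡ c} {q : ℓ v ≡ c} →
               u ≡ v → _≡_ {A = Σ V (λ w → ℓ w ≡ c)} (u , p) (v , q)
Σ-≡-by-proj₁ {p = p} {q} refl = cong (_ ,_) (Decidable⇒UIP.≡-irrelevant _≟ᵇ_ p q)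

Reach-invariant : (G : Graph) {C : Set} (c : Fin (n G) → C) →
                  (∀ u w → adj G u w ≡ true → c u ≡ c w) →
                  ∀ {u v} → Reach G u v → c u ≡ c v
Reach-invariant G c inv here       = refl
Reach-invariant G c inv (step e r) = trans (inv _ _ e) (Reach-invariant G c inv r)

Universal : {V : Set} → (V → V → Bool) → V → Set
Universal R x = ∀ y → y ≢ x → R x y ≡ true

universal-image : {V W : Set} {R : V → V → Bool} {S : W → W → Bool} (f : V ⤖ W) →
                  (∀ i j → R i j ≡ S (Bijection.to f i) (Bijection.to f j)) →
                  ∀ {x} → Universal R x → Universal S (Bijection.to f x)
universal-image {S = S} f f-adj {x} U y y≢fx
  with i , fi≡y ← Bijection.strictlySurjective f y = begin
    S (to x) y      ≡⟨ cong (S (to x)) (sym fi≡y) ⟩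
    S (to x) (to i) ≡⟨ sym (f-adj x i) ⟩
    _               ≡⟨ U i (λ i≡x → y≢fx (trans (sym fi≡y) (cong to i≡x))) ⟩
    true            ∎
  where open Bijection f using (to)
        open ≡-Reasoning

record Complement {A : Set} (a₀ : A) (B : Set) : Set where
  field
    embed           : B → A
    embed-injective : Injective _≡_ _≡_ embed
    embed-≢         : ∀ x → embed x ≢ a₀
    cover           : ∀ y → y ≡ a₀ ⊎ ∃ λ x → embed x ≡ y

  preimage : ∀ {y} → y ≢ a₀ → ∃ λ x → embed x ≡ y
  preimage {y} y≢a₀ with cover y
  ... | inj₁ y≡a₀ = ⊥-elim (y≢a₀ y≡a₀)
  ... | inj₂ x    = x

punchIn-complement : ∀ {n} (i : Fin n) → Complement i (Fin (pred n))
punchIn-complement {suc n} i = record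
  { embed           = punchIn i
  ; embed-injective = punchIn-injective i _ _
  ; embed-≢         = punchInᵢ≢i i
  ; cover           = cover
  }
  where
    cover : ∀ j → j ≡ i ⊎ ∃ λ k → punchIn i k ≡ j
    cover j with j ≟ᶠ i
    ... | yes j≡i = inj₁ j≡i
    ... | no  j≢i = inj₂ (punchOut (j≢i ∘ sym) , punchIn-punchOut _)

to-suc-onto : ∀ {A : Set} {k} (f : Fin (suc k) ⤖ A) {y} →
              y ≢ Bijection.to f zero → ∃ λ i → Bijection.to f (suc i) ≡ y
to-suc-onto f {y} y≢f0 with Bijection.strictlySurjective f y
... | zero  , f0≡y = ⊥-elim (y≢f0 (sym f0≡y))
... | suc i , fi≡y = i , fi≡y

module _ {A B : Set} {a₀ : A} (C : Complement a₀ B) where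
  open Complement C

  extend : ∀ {k} → Fin k ⤖ B → Fin (suc k) ⤖ A
  extend {k} f = mk⤖ (injective , strictlySurjective⇒surjective surjective)
    where
      open Bijection f using (to)

      h : Fin (suc k) → A
      h zero    = a₀
      h (suc i) = embed (to i)

      injective : Injective _≡_ _≡_ h
      injective {zero}  {zero}  _  = refl
      injective {zero}  {suc j} eq = ⊥-elim (embed-≢ (to j) (sym eq))
      injective {suc i} {zero}  eq = ⊥-elim (embed-≢ (to i) eq)
      injective {suc i} {suc j} eq = cong suc (Bijection.injective f (embed-injective eq))

      surjective : ∀ y → ∃ λ i → h i ≡ y
      surjective y with cover y
      ... | inj₁ y≡a₀         = zero , sym y≡a₀
      ... | inj₂ (x , ex≡y)
            with i , fi≡x ← Bijection.strictlySurjective f x = suc i , trans (cong embed fi≡x) ex≡y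

  restrict : ∀ {k} (f : Fin (suc k) ⤖ A) → Bijection.to f zero ≡ a₀ →
             Σ (Fin k ⤖ B) λ g → ∀ i → embed (Bijection.to g i) ≡ Bijection.to f (suc i)
  restrict {k} f f0≡a₀ = mk⤖ (injective , strictlySurjective⇒surjective surjective) , λ i → proj₂ (lift i)
    where
      open Bijection f using (to)

      lift : ∀ i → ∃ λ x → embed x ≡ to (suc i)
      lift i = preimage λ fi≡a₀ → 0≢1+n (Bijection.injective f (trans f0≡a₀ (sym fi≡a₀)))

      g : Fin k → B
      g i = proj₁ (lift i)

      injective : Injective _≡_ _≡_ g
      injective {i} {j} gi≡gj = suc-injective (Bijection.injective f
        (trans (sym (proj₂ (lift i))) (trans (cong embed gi≡gj) (proj₂ (lift j)))))

      surjective : ∀ x → ∃ λ i → g i ≡ x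
      surjective x with i , fi≡ex ← to-suc-onto f (λ ex≡f0 → embed-≢ x (trans ex≡f0 f0≡a₀)) =
        i , embed-injective (trans (proj₂ (lift i)) fi≡ex)

true≢false : true ≢ false
true≢false ()

universal-in-square : (P : PLGraph) (x : SqV P) → Universal (sqAdj P) x →
                      ∃ λ a → x ≡ inj₁ a × labeled P a ≡ true
universal-in-square P (inj₁ a) U =
  a , refl , ∧-conicalˡ _ _ (U (inj₂ (proper P)) λ ())
universal-in-square P (inj₂ x) U = ⊥-elim (true≢false (trans (sym c-labeled) c-unlabeled))
  where
    c = proj₁ (proper P)
    c-unlabeled = proj₂ (proper P)
    c-labeled = ∧-conicalʳ _ _ (U (inj₁ c) λ ())

SoleLabel : (P : PLGraph) → Fin (n (K P)) → Set
SoleLabel P a = ∀ b → labeled P b ≡ true → b ≡ a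

another-label? : (P : PLGraph) (a : Fin (n (K P))) →
                 (∃ λ b → labeled P b ≡ true × b ≢ a) ⊎ SoleLabel P a
another-label? P a with any? (λ b → (labeled P b ≟ᵇ true) ×-dec ¬? (b ≟ᶠ a))
... | yes other = inj₁ other
... | no ∄other = inj₂ λ b lb → decidable-stable (b ≟ᶠ a) λ b≢a → ∄other (b , lb , b≢a)

is-inj₁ : {A B : Set} → A ⊎ B → Bool
is-inj₁ (inj₁ _) = true
is-inj₁ (inj₂ _) = false

module _ (P : PLGraph) {a : Fin (n (K P))} (sole : SoleLabel P a) where

  square-edge-within-copy : ∀ x y → x ≢ inj₁ a → y ≢ inj₁ a → sqAdj P x y ≡ true →
                            is-inj₁ x ≡ is-inj₁ y
  square-edge-within-copy (inj₁ _) (inj₁ _) _ _ _ = refl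
  square-edge-within-copy (inj₂ _) (inj₂ _) _ _ _ = refl
  square-edge-within-copy (inj₁ b) (inj₂ _) x≢a _ e =
    ⊥-elim (x≢a (cong inj₁ (sole b (∧-conicalˡ _ _ e))))
  square-edge-within-copy (inj₂ _) (inj₁ d) _ y≢a e =
    ⊥-elim (y≢a (cong inj₁ (sole d (∧-conicalʳ _ _ e))))

  -- No edge of KK joins the two copies of K ∖ a, so no connected H maps onto KK minus a.
  sole-label-disconnects : (H : Graph) → Connected H → (φ : Fin (n H) → SqV P) →
                           (∀ u → φ u ≢ inj₁ a) →
                           (∀ u w → adj H u w ≡ true → sqAdj P (φ u) (φ w) ≡ true) →
                           (∀ {y} → y ≢ inj₁ a → ∃ λ u → φ u ≡ y) → ⊥
  sole-label-disconnects H conn φ avoid hom onto = true≢false (begin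
      true                 ≡⟨ cong is-inj₁ (sym (proj₂ first)) ⟩
      is-inj₁ (φ u₁)       ≡⟨ Reach-invariant H (is-inj₁ ∘ φ) same-copy (conn u₁ u₂) ⟩
      is-inj₁ (φ u₂)       ≡⟨ cong is-inj₁ (proj₂ second) ⟩
      false                ∎)
    where
      open ≡-Reasoning
      c = proj₁ (proper P)
      c-unlabeled = proj₂ (proper P)

      c≢a : c ≢ a
      c≢a refl = true≢false (begin
        true              ≡⟨ sym (proj₂ (nonempty P)) ⟩
        labeled P _       ≡⟨ cong (labeled P) (sole _ (proj₂ (nonempty P))) ⟩
        labeled P c       ≡⟨ c-unlabeled ⟩
        false             ∎)

      first  = onto {inj₁ c} (c≢a ∘ inj₁-injective)
      second = onto {inj₂ (c , c-unlabeled)} (λ ())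
      u₁ = proj₁ first
      u₂ = proj₁ second

      same-copy : ∀ u w → adj H u w ≡ true → is-inj₁ (φ u) ≡ is-inj₁ (φ w)
      same-copy u w e = square-edge-within-copy (φ u) (φ w) (avoid u) (avoid w) (hom u w e)

apex-labeled : (P : PLGraph) → Fin (suc (n (K P))) → Bool
apex-labeled P zero    = true
apex-labeled P (suc v) = labeled P v

cone : PLGraph → PLGraph
cone P = record
  { K        = K P ∇K₁
  ; labeled  = apex-labeled P
  ; nonempty = zero , refl
  ; proper   = suc (proj₁ (proper P)) , proj₂ (proper P)
  }

module _ (P : PLGraph) where

  shift : SqV P → SqV (cone P)
  shift (inj₁ a)       = inj₁ (suc a)
  shift (inj₂ (a , p)) = inj₂ (suc a , p)

  cone-complement : Complement (inj₁ zero) (SqV P)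
  cone-complement = record
    { embed           = shift
    ; embed-injective = injective
    ; embed-≢         = ≢apex
    ; cover           = cover
    }
    where
      injective : Injective _≡_ _≡_ shift
      injective {inj₁ _} {inj₁ _} refl = refl
      injective {inj₂ _} {inj₂ _} refl = refl

      ≢apex : ∀ x → shift x ≢ inj₁ zero
      ≢apex (inj₁ _) ()
      ≢apex (inj₂ _) ()

      cover : ∀ y → y ≡ inj₁ zero ⊎ ∃ λ x → shift x ≡ y
      cover (inj₁ zero)       = inj₁ refl
      cover (inj₁ (suc a))    = inj₂ (inj₁ a , refl)
      cover (inj₂ (suc a , p)) = inj₂ (inj₂ (a , p) , refl)

  shift-adj : ∀ x y → sqAdj (cone P) (shift x) (shift y) ≡ sqAdj P x y
  shift-adj (inj₁ _) (inj₁ _) = refl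
  shift-adj (inj₁ _) (inj₂ _) = refl
  shift-adj (inj₂ _) (inj₁ _) = refl
  shift-adj (inj₂ _) (inj₂ _) = refl

  apex-adj-shift : ∀ x → sqAdj (cone P) (inj₁ zero) (shift x) ≡ true
  apex-adj-shift (inj₁ _) = refl
  apex-adj-shift (inj₂ _) = refl

  shift-adj-apex : ∀ x → sqAdj (cone P) (shift x) (inj₁ zero) ≡ true
  shift-adj-apex (inj₁ _) = refl
  shift-adj-apex (inj₂ _) = refl

cone-square : (G : Graph) (P : PLGraph) → IsoToSquare G P → IsoToSquare (G ∇K₁) (cone P)
cone-square G P (f , f-adj) = F , adj-eq
  where
    open Bijection f using (to)

    F : Fin (suc (n G)) ⤖ SqV (cone P)
    F = extend (cone-complement P) f

    adj-eq : ∀ i j → joinAdj G i j ≡ sqAdj (cone P) (Bijection.to F i) (Bijection.to F j)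
    adj-eq zero    zero    = refl
    adj-eq zero    (suc j) = sym (apex-adj-shift P (to j))
    adj-eq (suc i) zero    = sym (shift-adj-apex P (to i))
    adj-eq (suc i) (suc j) = trans (f-adj i j) (sym (shift-adj P (to i) (to j)))

module Deletion (P : PLGraph) {a : Fin (n (K P))} (a-labeled : labeled P a ≡ true)
                {b : Fin (n (K P))} (b-labeled : labeled P b ≡ true) (b≢a : b ≢ a) where
  open Complement (punchIn-complement a) using ()
    renaming (embed to skip; embed-injective to skip-injective; embed-≢ to skip-≢;
              cover to skip-cover; preimage to skip-preimage)

  unlabeled≢a : ∀ {d} → labeled P d ≡ false → d ≢ a
  unlabeled≢a ld refl = true≢false (trans (sym a-labeled) ld)

  labeled-at-preimage : ∀ {d} (e : ∃ λ k → skip k ≡ d) {c} → labeled P d ≡ c → labeled P (skip (proj₁ e)) ≡ c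
  labeled-at-preimage (k , refl) ld = ld

  K∖a : Graph
  K∖a = record
    { n      = pred (n (K P))
    ; adj    = λ u v → adj (K P) (skip u) (skip v)
    ; sym    = λ u v → Graph.sym (K P) (skip u) (skip v)
    ; irrefl = λ u → irrefl (K P) (skip u)
    }

  P∖a : PLGraph
  P∖a = record
    { K        = K∖a
    ; labeled  = labeled P ∘ skip
    ; nonempty = _ , labeled-at-preimage (skip-preimage b≢a) b-labeled
    ; proper   = _ , labeled-at-preimage (skip-preimage (unlabeled≢a c-unlabeled)) c-unlabeled
    }
    where c-unlabeled = proj₂ (proper P)

  include : SqV P∖a → SqV P
  include (inj₁ u)       = inj₁ (skip u)
  include (inj₂ (u , p)) = inj₂ (skip u , p)

  deletion-complement : Complement (inj₁ a) (SqV P∖a)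
  deletion-complement = record
    { embed           = include
    ; embed-injective = injective
    ; embed-≢         = ≢a
    ; cover           = cover
    }
    where
      injective : Injective _≡_ _≡_ include
      injective {inj₁ _} {inj₁ _} e = cong inj₁ (skip-injective (inj₁-injective e))
      injective {inj₂ _} {inj₂ _} e =
        cong inj₂ (Σ-≡-by-proj₁ (skip-injective (cong proj₁ (inj₂-injective e))))
      injective {inj₁ _} {inj₂ _} ()
      injective {inj₂ _} {inj₁ _} ()

      ≢a : ∀ x → include x ≢ inj₁ a
      ≢a (inj₁ u) = skip-≢ u ∘ inj₁-injective
      ≢a (inj₂ _) ()

      cover : ∀ y → y ≡ inj₁ a ⊎ ∃ λ x → include x ≡ y
      cover (inj₁ d) with skip-cover d
      ... | inj₁ d≡a       = inj₁ (cong inj₁ d≡a)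
      ... | inj₂ (k , k↦d) = inj₂ (inj₁ k , cong inj₁ k↦d)
      cover (inj₂ (d , ld)) =
        inj₂ (inj₂ (_ , labeled-at-preimage e ld) , cong inj₂ (Σ-≡-by-proj₁ (proj₂ e)))
        where e = skip-preimage (unlabeled≢a ld)

  include-adj : ∀ x y → sqAdj P (include x) (include y) ≡ sqAdj P∖a x y
  include-adj (inj₁ _) (inj₁ _) = refl
  include-adj (inj₁ _) (inj₂ _) = refl
  include-adj (inj₂ _) (inj₁ _) = refl
  include-adj (inj₂ _) (inj₂ _) = refl

∇K₁-apex-universal : (G : Graph) → Universal (joinAdj G) zero
∇K₁-apex-universal G zero    0≢0 = ⊥-elim (0≢0 refl)
∇K₁-apex-universal G (suc j) _   = refl

module SquareOfCone (G : Graph) (P : PLGraph) (f : Fin (suc (n G)) ⤖ SqV P)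
         (f-adj : ∀ i j → joinAdj G i j ≡ sqAdj P (Bijection.to f i) (Bijection.to f j)) where
  open Bijection f using (to; injective)

  apex-image : ∃ λ a → to zero ≡ inj₁ a × labeled P a ≡ true
  apex-image = universal-in-square P (to zero)
    (universal-image {R = joinAdj G} {S = sqAdj P} f f-adj (∇K₁-apex-universal G))

  module _ {a : Fin (n (K P))} (apex↦a : to zero ≡ inj₁ a) where

    apex-not-sole-label : Connected G → ¬ SoleLabel P a
    apex-not-sole-label conn sole = sole-label-disconnects P sole G conn (to ∘ suc) avoids hom onto
      where
        avoids : ∀ u → to (suc u) ≢ inj₁ a
        avoids u u↦a with () ← injective (trans u↦a (sym apex↦a))

        hom : ∀ u w → adj G u w ≡ true → sqAdj P (to (suc u)) (to (suc w)) ≡ true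
        hom u w e = trans (sym (f-adj (suc u) (suc w))) e

        onto : ∀ {y} → y ≢ inj₁ a → ∃ λ u → to (suc u) ≡ y
        onto y≢a = to-suc-onto f (λ y≡apex → y≢a (trans y≡apex apex↦a))

    delete-apex : (a-labeled : labeled P a ≡ true) {b : Fin (n (K P))}
                  (b-labeled : labeled P b ≡ true) (b≢a : b ≢ a) →
                  IsoToSquare G (Deletion.P∖a P a-labeled b-labeled b≢a)
    delete-apex a-labeled b-labeled b≢a = g , g-adj
      where
        open Deletion P a-labeled b-labeled b≢a
        open ≡-Reasoning

        restricted = restrict deletion-complement f apex↦a

        g : Fin (n G) ⤖ SqV P∖a
        g = proj₁ restricted

        h : Fin (n G) → SqV P∖a
        h = Bijection.to g

        include∘h : ∀ i → include (h i) ≡ to (suc i)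
        include∘h = proj₂ restricted

        g-adj : ∀ i j → adj G i j ≡ sqAdj P∖a (h i) (h j)
        g-adj i j = begin
          adj G i j                             ≡⟨ f-adj (suc i) (suc j) ⟩
          sqAdj P (to (suc i)) (to (suc j))     ≡⟨ sym (cong₂ (sqAdj P) (include∘h i) (include∘h j)) ⟩
          sqAdj P (include (h i)) (include (h j)) ≡⟨ include-adj (h i) (h j) ⟩
          sqAdj P∖a (h i) (h j)                 ∎

cone-square⇒square : (G : Graph) → Connected G → (P : PLGraph) → IsoToSquare (G ∇K₁) P → IsSquare G
cone-square⇒square G conn P (f , f-adj) = case-on-labels apex-image
  where
    open SquareOfCone G P f f-adj

    case-on-labels : (∃ λ a → Bijection.to f zero ≡ inj₁ a × labeled P a ≡ true) → IsSquare G
    case-on-labels (a , apex↦a , a-labeled) with another-label? P a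
    ... | inj₁ (b , b-labeled , b≢a) = _ , delete-apex apex↦a a-labeled b-labeled b≢a
    ... | inj₂ sole                  = ⊥-elim (apex-not-sole-label apex↦a conn sole)

corollary5p10 : (G : Graph) → Connected G → (IsSquare G ⇔ IsSquare (G ∇K₁))
corollary5p10 G conn = mk⇔ (λ (P , iso) → cone P , cone-square G P iso)
                           (λ (P , iso) → cone-square⇒square G conn P iso)
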